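{- Let $\{V_j\}_{j\ge1}$ be a sequence of positive integers with $V_j=V_{j-1}+V_{j-2}$ for all $j\ge 3$, let $n\ge1$ be an integer and $d\ge 2$ an even integer, and assume $\gcd(V_1,V_2)=1$ and $\gcd(V_n,F_d)=1$. Let $S=\langle V_n,V_{n+d},V_{n+2d},\ldots\rangle$. Then the embedding dimension of $S$ is $\mathbf e(S)=\kappa$, where $\kappa$ is the smallest positive integer for which $F_{\kappa d}/F_d\ge V_n$.
   Context: $F_j$ denotes the $j$-th Fibonacci number ($F_0=0$, $F_1=F_2=1$, $F_j=F_{j-1}+F_{j-2}$). For a set $A$ of positive integers, $\langle A\rangle$ denotes the set of all finite linear combinations of elements of $A$ with non-negative integer coefficients; under the hypotheses, $S$ is a numerical semigroup (a submonoid of $\mathbb Z_{\ge0}$ with finite complement). The embedding dimension $\mathbf e(S)$ is the cardinality of the unique minimal generating set $S^\star\setminus(S^\star+S^\star)$ of $S$, where $S^\star=S\setminus\{0\}$. -}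

module Defs where

open import Data.Nat using (ℕ; zero; suc; _+_; _*_; _≤_; _<_)
open import Data.Product using (Σ; _×_; ∃)
open import Data.List using (List; length)
open import Data.List.Membership.Propositional using (_∈_)
open import Data.List.Relation.Unary.Unique.Propositional using (Unique)
open import Relation.Binary.PropositionalEquality using (_≡_)
open import Relation.Nullary using (¬_)
open import Function.Bundles using (_⇔_)

F : ℕ → ℕ
F zero = 0
F (suc zero) = 1
F (suc (suc j)) = F (suc j) + F j

data ⟨_⟩ (A : ℕ → Set) : ℕ → Set where
  empty : ⟨ A ⟩ 0
  add   : ∀ {a x} → A a → ⟨ A ⟩ x → ⟨ A ⟩ (a + x)

Star : (ℕ → Set) → ℕ → Set
Star S x = S x × ¬ (x ≡ 0)

MinGen : (ℕ → Set) → ℕ → Set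
MinGen S x = Star S x × ¬ (Σ ℕ λ y → Σ ℕ λ z → Star S y × Star S z × x ≡ y + z)

EmbeddingDimension : (ℕ → Set) → ℕ → Set
EmbeddingDimension S e =
  Σ (List ℕ) λ xs → length xs ≡ e × Unique xs × (∀ x → (x ∈ xs) ⇔ MinGen S x)

GenSet : (ℕ → ℕ) → ℕ → ℕ → ℕ → Set
GenSet V n d x = Σ ℕ λ k → x ≡ V (n + k * d)

{-# OPTIONS --safe #-}

-- Write a = V n, c = V (n + 1) and g k = V (n + k d) = F (kd − 1) a + F (kd) c. For even d,
-- d'Ocagne's identity F (jd − 1) F (kd) − F (jd) F (kd − 1) = F ((k − j) d) shows that any sum x of
-- generators g j with j < k can be written p a + q c with F d ∣ q and p F (kd) − q F (kd − 1) = t,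
-- where 0 < t < F d · x as long as F (md) < a F d for 1 ≤ m ≤ k. For x = g k this is impossible:
-- comparing with g k = F (kd − 1) a + F (kd) c makes a F d divide a positive number r with
-- r · g k = t a, forcing t ≥ F d · g k. Conversely, once a F d ≤ F (kd), write F (kd) = u F d and
-- divide u by a: this expresses g k as x a + y g 1. Hence the minimal generators are exactly g 0, …, g (κ − 1).
module Submission where

open import Defs
open import Data.Nat using (ℕ; zero; suc; _+_; _*_; _∸_; _≤_; _<_; NonZero; >-nonZero; _≤′_; ≤′-refl; ≤′-step; _≤?_; _≟_; z≤n; s≤s)
open import Data.Nat.Properties
open import Data.Nat.Divisibility using (_∣_; divides; _∣0; ∣-refl; ∣m∣n⇒∣m+n; ∣m+n∣m⇒∣n; ∣m⇒∣m*n; ∣n⇒∣m*n; n∣m*n; *-monoʳ-∣; ∣⇒≤)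
open import Data.Nat.DivMod using (_/_; _%_; m≡m%n+[m/n]*n; m%n<n; m≥n⇒m/n>0)
open import Data.Nat.Coprimality using (Coprime; coprime-+; coprime-divisor; gcd≡1⇒coprime)
import Data.Nat.Coprimality as Coprime
open import Data.Nat.GCD using (gcd)
open import Data.Nat.Induction using (<-rec)
open import Data.Nat.Tactic.RingSolver using (solve; solve-∀)
open import Data.Product using (Σ; ∃-syntax; _×_; _,_; proj₁)
open import Relation.Binary using (tri<; tri≈; tri>)
open import Data.List using ([]; _∷_; applyUpTo)
open import Data.List.Properties using (length-applyUpTo)
open import Data.List.Membership.Propositional using (_∈_)
open import Data.List.Membership.Propositional.Properties using (∈-applyUpTo⁺; ∈-applyUpTo⁻)
open import Data.List.Relation.Unary.Unique.Propositional.Properties using (applyUpTo⁺₁)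
open import Data.Empty using (⊥-elim)
open import Function.Bundles using (_⇔_; mk⇔; Equivalence)
open import Level using (0ℓ)
open import Relation.Binary.PropositionalEquality
open import Relation.Nullary using (¬_; yes; no)
open import Relation.Unary using (Pred; Decidable; _⊆_; _∩_)

-- F′ m = F (m ∸ 1), with F′ 0 = 1 so that F′ also satisfies the Fibonacci recurrence from 0 on.
F′ : ℕ → ℕ
F′ zero = 1
F′ (suc m) = F m

combination-+ : ∀ p q r s x y → (p * x + r * y) + (q * x + s * y) ≡ (p + q) * x + (r + s) * y
combination-+ = solve-∀

cross-+ : ∀ p₁ p₂ q₁ q₂ t₁ t₂ {u v} → p₁ * u ≡ q₁ * v + t₁ → p₂ * u ≡ q₂ * v + t₂ →
          (p₁ + p₂) * u ≡ (q₁ + q₂) * v + (t₁ + t₂)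
cross-+ p₁ p₂ q₁ q₂ t₁ t₂ {u} {v} e₁ e₂ = begin
  (p₁ + p₂) * u                   ≡⟨ *-distribʳ-+ u p₁ p₂ ⟩
  p₁ * u + p₂ * u                 ≡⟨ cong₂ _+_ e₁ e₂ ⟩
  (q₁ * v + t₁) + (q₂ * v + t₂)   ≡⟨ solve (q₁ ∷ q₂ ∷ t₁ ∷ t₂ ∷ v ∷ []) ⟩
  (q₁ + q₂) * v + (t₁ + t₂)       ∎
  where open ≡-Reasoning

IsFibonacciFrom : ℕ → (ℕ → ℕ) → Set
IsFibonacciFrom n W = ∀ j → n ≤ j → W (suc (suc j)) ≡ W (suc j) + W j

F-isFibonacci : ∀ {n} → IsFibonacciFrom n F
F-isFibonacci _ _ = refl

F′-isFibonacci : ∀ {n} → IsFibonacciFrom n F′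
F′-isFibonacci zero _ = refl
F′-isFibonacci (suc _) _ = refl

fibonacci-expand : ∀ {n} W → IsFibonacciFrom n W →
                   ∀ m → W (m + n) ≡ F′ m * W n + F m * W (suc n)
fibonacci-expand {n} W _ zero = sym (trans (+-identityʳ _) (+-identityʳ (W n)))
fibonacci-expand W _ (suc zero) = sym (+-identityʳ _)
fibonacci-expand {n} W rec (suc (suc m)) = begin
  W (suc (suc (m + n)))
    ≡⟨ rec (m + n) (m≤n+m n m) ⟩
  W (suc m + n) + W (m + n)
    ≡⟨ cong₂ _+_ (fibonacci-expand W rec (suc m)) (fibonacci-expand W rec m) ⟩
  (F′ (suc m) * W n + F (suc m) * W (suc n)) + (F′ m * W n + F m * W (suc n))
    ≡⟨ combination-+ (F′ (suc m)) (F′ m) (F (suc m)) (F m) (W n) (W (suc n)) ⟩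
  (F′ (suc m) + F′ m) * W n + F (suc (suc m)) * W (suc n)
    ≡⟨ cong (λ t → t * W n + F (suc (suc m)) * W (suc n)) (sym (F′-isFibonacci {0} m z≤n)) ⟩
  F′ (suc (suc m)) * W n + F (suc (suc m)) * W (suc n) ∎
  where open ≡-Reasoning

F-pos : ∀ {m} → 0 < m → 0 < F m
F-pos {suc zero} _ = s≤s z≤n
F-pos {suc (suc m)} _ = ≤-trans (F-pos {suc m} (s≤s z≤n)) (m≤m+n _ _)

F′-pos : ∀ {m} → 2 ≤ m → 0 < F′ m
F′-pos {suc (suc m)} _ = F-pos {suc m} (s≤s z≤n)
F′-pos {suc zero} (s≤s ())

F-≤-suc : ∀ m → F m ≤ F (suc m)
F-≤-suc zero = z≤n
F-≤-suc (suc m) = m≤m+n _ _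

F-mono-≤ : ∀ {m n} → m ≤ n → F m ≤ F n
F-mono-≤ m≤n = mono′ (≤⇒≤′ m≤n)
  where
  mono′ : ∀ {m n} → m ≤′ n → F m ≤ F n
  mono′ ≤′-refl = ≤-refl
  mono′ {n = suc n} (≤′-step m≤′n) = ≤-trans (mono′ m≤′n) (F-≤-suc n)

F-∣-F-* : ∀ d k → F d ∣ F (k * d)
F-∣-F-* d zero = F d ∣0
F-∣-F-* d (suc k) =
  subst (F d ∣_) (sym (fibonacci-expand {k * d} F F-isFibonacci d))
    (∣m∣n⇒∣m+n (∣n⇒∣m*n (F′ d) (F-∣-F-* d k)) (∣m⇒∣m*n (F (suc (k * d))) ∣-refl))

*-F-≤-F-* : ∀ {d} → 2 ≤ d → ∀ k → k * F d ≤ F (k * d)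
*-F-≤-F-* _ zero = z≤n
*-F-≤-F-* {d} 2≤d (suc k) = begin
  F d + k * F d
    ≤⟨ +-mono-≤ (m≤m*n (F d) (F (suc (k * d))) ⦃ >-nonZero (F-pos {suc (k * d)} (s≤s z≤n)) ⦄)
                (≤-trans (*-F-≤-F-* 2≤d k) (m≤n*m (F (k * d)) (F′ d) ⦃ >-nonZero (F′-pos 2≤d) ⦄)) ⟩
  F d * F (suc (k * d)) + F′ d * F (k * d)
    ≡⟨ +-comm (F d * F (suc (k * d))) (F′ d * F (k * d)) ⟩
  F′ d * F (k * d) + F d * F (suc (k * d))
    ≡⟨ sym (fibonacci-expand {k * d} F F-isFibonacci d) ⟩
  F (suc k * d) ∎
  where open ≤-Reasoning

F-+-F-≤ : ∀ {d} → 2 ≤ d → ∀ m → F m + F m ≤ F (d + m)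
F-+-F-≤ 2≤d m = ≤-trans (+-monoˡ-≤ (F m) (F-≤-suc m)) (F-mono-≤ (+-monoˡ-≤ m 2≤d))

cassini-even⇒odd : ∀ x y p → x ≡ y + p → x * p ≡ y * y + 1 → (x + y) * y + 1 ≡ x * x
cassini-even⇒odd _ y p refl even = begin
  (y + p + y) * y + 1         ≡⟨ solve (y ∷ p ∷ []) ⟩
  (y + p) * y + (y * y + 1)   ≡⟨ cong ((y + p) * y +_) (sym even) ⟩
  (y + p) * y + (y + p) * p   ≡⟨ sym (*-distribˡ-+ (y + p) y p) ⟩
  (y + p) * (y + p)           ∎
  where open ≡-Reasoning

cassini-odd⇒even : ∀ y z → (y + z) * z + 1 ≡ y * y → (y + z + y) * y ≡ (y + z) * (y + z) + 1
cassini-odd⇒even y z odd = begin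
  (y + z + y) * y               ≡⟨ solve (y ∷ z ∷ []) ⟩
  (y + z) * y + y * y           ≡⟨ cong ((y + z) * y +_) (sym odd) ⟩
  (y + z) * y + ((y + z) * z + 1) ≡⟨ solve (y ∷ z ∷ []) ⟩
  (y + z) * (y + z) + 1         ∎
  where open ≡-Reasoning

cassini-even : ∀ h → F (suc (h * 2)) * F′ (h * 2) ≡ F (h * 2) * F (h * 2) + 1
cassini-odd : ∀ h → F (suc (suc (h * 2))) * F (h * 2) + 1 ≡ F (suc (h * 2)) * F (suc (h * 2))

cassini-even zero = refl
cassini-even (suc h) = cassini-odd⇒even (F (suc (h * 2))) (F (h * 2)) (cassini-odd h)

cassini-odd h = cassini-even⇒odd (F (suc (h * 2))) (F (h * 2)) (F′ (h * 2))
  (F′-isFibonacci {0} (h * 2) z≤n) (cassini-even h)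

cassini : ∀ {e} → 2 ∣ e → F (suc e) * F′ e ≡ F e * F e + 1
cassini (divides h refl) = cassini-even h

F-dOcagne : ∀ {e} → 2 ∣ e → ∀ r → F′ e * F (e + r) ≡ F e * F′ (e + r) + F r
F-dOcagne {e} 2∣e r rewrite +-comm e r = begin
  F′ e * F (r + e)                        ≡⟨ cong (F′ e *_) (fibonacci-expand F F-isFibonacci r) ⟩
  F′ e * (F′ r * F e + F r * F (suc e))   ≡⟨ regroup (F′ e) (F′ r) (F e) (F r) (F (suc e)) (cassini 2∣e) ⟩
  F e * (F′ r * F′ e + F r * F e) + F r   ≡⟨ cong (λ t → F e * t + F r) (sym (fibonacci-expand F′ F′-isFibonacci r)) ⟩
  F e * F′ (r + e) + F r                  ∎
  where
  open ≡-Reasoning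
  regroup : ∀ p q s t u → u * p ≡ s * s + 1 → p * (q * s + t * u) ≡ s * (q * p + t * s) + t
  regroup p q s t u up≡ss+1 = begin
    p * (q * s + t * u)          ≡⟨ solve (p ∷ q ∷ s ∷ t ∷ u ∷ []) ⟩
    s * (q * p) + t * (u * p)    ≡⟨ cong (λ v → s * (q * p) + t * v) up≡ss+1 ⟩
    s * (q * p) + t * (s * s + 1) ≡⟨ solve (p ∷ q ∷ s ∷ t ∷ []) ⟩
    s * (q * p + t * s) + t      ∎

least-witness : ∀ {P : Pred ℕ 0ℓ} → Decidable P → ∀ {m} → P m →
                ∃[ k ] P k × (∀ {j} → j < k → ¬ P j)
least-witness {P} P? {m} = <-rec (λ m → P m → Least) search m
  where
  Least : Set
  Least = ∃[ k ] P k × (∀ {j} → j < k → ¬ P j)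
  search : ∀ m → (∀ {j} → j < m → P j → Least) → P m → Least
  search m below Pm with anyUpTo? P? m
  ... | yes (j , j<m , Pj) = below j<m Pj
  ... | no none = m , Pm , λ j<m Pj → none (_ , j<m , Pj)

variable
  A B : Pred ℕ 0ℓ
  x y m : ℕ

⟨⟩-gen : A x → ⟨ A ⟩ x
⟨⟩-gen {x = x} Ax = subst ⟨ _ ⟩ (+-identityʳ x) (add Ax empty)

⟨⟩-+ : ⟨ A ⟩ x → ⟨ A ⟩ y → ⟨ A ⟩ (x + y)
⟨⟩-+ empty Sy = Sy
⟨⟩-+ {y = y} (add {a} {x} Aa Sx) Sy = subst ⟨ _ ⟩ (sym (+-assoc a x y)) (add Aa (⟨⟩-+ Sx Sy))

⟨⟩-* : ∀ m → A x → ⟨ A ⟩ (m * x)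
⟨⟩-* zero _ = empty
⟨⟩-* (suc m) Ax = add Ax (⟨⟩-* m Ax)

⟨⟩-mono : A ⊆ B → ⟨ A ⟩ ⊆ ⟨ B ⟩
⟨⟩-mono A⊆B empty = empty
⟨⟩-mono A⊆B (add Aa Sx) = add (A⊆B Aa) (⟨⟩-mono A⊆B Sx)

⟨⟩-∩-< : ⟨ A ⟩ x → x < m → ⟨ A ∩ (_< m) ⟩ x
⟨⟩-∩-< empty _ = empty
⟨⟩-∩-< (add {a} {x} Aa Sx) a+x<m =
  add (Aa , ≤-<-trans (m≤m+n a x) a+x<m) (⟨⟩-∩-< Sx (≤-<-trans (m≤n+m x a) a+x<m))

Decomposable : Pred ℕ 0ℓ → Pred ℕ 0ℓ
Decomposable S x = Σ ℕ λ y → Σ ℕ λ z → Star S y × Star S z × x ≡ y + z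

decomposable⇒⟨∩<⟩ : Decomposable ⟨ A ⟩ x → ⟨ A ∩ (_< x) ⟩ x
decomposable⇒⟨∩<⟩ (y , z , (Sy , y≢0) , (Sz , z≢0) , refl) =
  ⟨⟩-+ (⟨⟩-∩-< Sy (m<m+n y (n≢0⇒n>0 z≢0))) (⟨⟩-∩-< Sz (m<n+m z (n≢0⇒n>0 y≢0)))

⟨∩<⟩⇒decomposable : ⟨ A ∩ (_< m) ⟩ x → m ≤ x → 0 < x → Decomposable ⟨ A ⟩ x
⟨∩<⟩⇒decomposable (add {a} {x} (Aa , a<m) Sx) m≤a+x 0<a+x with a ≟ 0 | x ≟ 0
... | yes refl | _ = ⟨∩<⟩⇒decomposable Sx m≤a+x 0<a+x
... | no _ | yes refl = ⊥-elim (<⇒≱ a<m (subst (_ ≤_) (+-identityʳ a) m≤a+x))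
... | no a≢0 | no x≢0 = a , x , (⟨⟩-gen Aa , a≢0) , (⟨⟩-mono proj₁ Sx , x≢0) , refl

indecomposable⇒gen : ⟨ A ⟩ x → x ≢ 0 → ¬ Decomposable ⟨ A ⟩ x → A x
indecomposable⇒gen empty 0≢0 _ = ⊥-elim (0≢0 refl)
indecomposable⇒gen {A = A} (add {a} {x} Aa Sx) a+x≢0 indecomposable with a ≟ 0 | x ≟ 0
... | _ | yes refl = subst A (sym (+-identityʳ a)) Aa
... | yes refl | no _ = indecomposable⇒gen Sx a+x≢0 indecomposable
... | no a≢0 | no x≢0 = ⊥-elim (indecomposable (a , x , (⟨⟩-gen Aa , a≢0) , (Sx , x≢0) , refl))

MinGen⟨⟩⇔ : MinGen ⟨ A ⟩ x ⇔ (A x × x ≢ 0 × ¬ ⟨ A ∩ (_< x) ⟩ x)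
MinGen⟨⟩⇔ = mk⇔
  (λ ((Sx , x≢0) , indecomposable) →
     indecomposable⇒gen Sx x≢0 indecomposable , x≢0 ,
     λ Sx<x → indecomposable (⟨∩<⟩⇒decomposable Sx<x ≤-refl (n≢0⇒n>0 x≢0)))
  (λ (Ax , x≢0 , irreducible) → (⟨⟩-gen Ax , x≢0) , λ dec → irreducible (decomposable⇒⟨∩<⟩ dec))

coprime-*-∣ : ∀ {a f r} → Coprime a f → a ∣ r → f ∣ r → a * f ∣ r
coprime-*-∣ {a} {f} a⊥f (divides s refl) f∣sa =
  subst (a * f ∣_) (*-comm a s)
    (*-monoʳ-∣ a (coprime-divisor (Coprime.sym a⊥f) (subst (f ∣_) (*-comm s a) f∣sa)))

subtract-shift : ∀ {a b g r t u w} → u * b ≡ g + w * a → u ≡ r + t * a → w ≤ t * b →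
                 g ≡ (t * b ∸ w) * a + r * b
subtract-shift {a} {b} {g} {r} {t} {u} {w} ub≡g+wa u≡r+ta w≤tb = +-cancelʳ-≡ (w * a) _ _ (begin
  g + w * a                        ≡⟨ sym ub≡g+wa ⟩
  u * b                            ≡⟨ cong (_* b) u≡r+ta ⟩
  (r + t * a) * b                  ≡⟨ solve (a ∷ b ∷ r ∷ t ∷ []) ⟩
  (t * b) * a + r * b              ≡⟨ cong (λ s → s * a + r * b) (sym (m∸n+n≡m w≤tb)) ⟩
  (t * b ∸ w + w) * a + r * b      ≡⟨ regroup (t * b ∸ w) w a r b ⟩
  (t * b ∸ w) * a + r * b + w * a  ∎)
  where
  open ≡-Reasoning
  regroup : ∀ x w a r b → (x + w) * a + r * b ≡ x * a + r * b + w * a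
  regroup = solve-∀

-- (v − q) g = t a, and v − q is a positive multiple of a (as a ⊥ c) and of f, hence of a f.
cross-bound : ∀ {a c f g u v p q t} → 0 < a → Coprime a c → Coprime a f → f ∣ v → f ∣ q →
              g ≡ u * a + v * c → g ≡ p * a + q * c → p * v ≡ q * u + t → 0 < t → f * g ≤ t
cross-bound {a} {c} {f} {g} {u} {v} {p} {q} {t} 0<a a⊥c a⊥f f∣v f∣q g≡ua+vc g≡pa+qc pv≡qu+t 0<t =
  bound (m≤n⇒∃[o]m+o≡n (<⇒≤ q<v))
  where
  vg≡qg+ta : v * g ≡ q * g + t * a
  vg≡qg+ta = begin
    v * g                         ≡⟨ cong (v *_) g≡pa+qc ⟩
    v * (p * a + q * c)           ≡⟨ solve (a ∷ c ∷ v ∷ p ∷ q ∷ []) ⟩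
    (p * v) * a + q * (v * c)     ≡⟨ cong (λ w → w * a + q * (v * c)) pv≡qu+t ⟩
    (q * u + t) * a + q * (v * c) ≡⟨ solve (a ∷ c ∷ u ∷ v ∷ q ∷ t ∷ []) ⟩
    q * (u * a + v * c) + t * a   ≡⟨ cong (λ w → q * w + t * a) (sym g≡ua+vc) ⟩
    q * g + t * a                 ∎
    where open ≡-Reasoning

  q<v : q < v
  q<v = *-cancelʳ-< g q v (subst (q * g <_) (sym vg≡qg+ta) (m<m+n (q * g) (*-mono-< 0<t 0<a)))

  bound : ∃[ r ] q + r ≡ v → f * g ≤ t
  bound (r , q+r≡v) = *-cancelʳ-≤ (f * g) t a ⦃ >-nonZero 0<a ⦄ (begin
    f * g * a   ≡⟨ solve (a ∷ f ∷ g ∷ []) ⟩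
    a * f * g   ≤⟨ *-monoˡ-≤ g (∣⇒≤ ⦃ >-nonZero 0<r ⦄ (coprime-*-∣ a⊥f a∣r f∣r)) ⟩
    r * g       ≡⟨ rg≡ta ⟩
    t * a       ∎)
    where
    open ≤-Reasoning
    rg≡ta : r * g ≡ t * a
    rg≡ta = +-cancelˡ-≡ (q * g) _ _
      (trans (sym (*-distribʳ-+ g q r)) (trans (cong (_* g) q+r≡v) vg≡qg+ta))
    0<r : 0 < r
    0<r = n≢0⇒n>0 λ { refl → <⇒≢ (*-mono-< 0<t 0<a) rg≡ta }
    ua+rc≡pa : u * a + r * c ≡ p * a
    ua+rc≡pa = +-cancelʳ-≡ (q * c) _ _ (begin-equality
      u * a + r * c + q * c   ≡⟨ solve (a ∷ c ∷ u ∷ q ∷ r ∷ []) ⟩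
      u * a + (q + r) * c     ≡⟨ cong (λ w → u * a + w * c) q+r≡v ⟩
      u * a + v * c           ≡⟨ trans (sym g≡ua+vc) g≡pa+qc ⟩
      p * a + q * c           ∎)
    a∣r : a ∣ r
    a∣r = coprime-divisor a⊥c (subst (a ∣_) (*-comm r c)
            (∣m+n∣m⇒∣n (subst (a ∣_) (sym ua+rc≡pa) (n∣m*n p)) (n∣m*n u)))
    f∣r : f ∣ r
    f∣r = ∣m+n∣m⇒∣n (subst (f ∣_) (sym q+r≡v) f∣v) f∣q

module FibonacciLike (V : ℕ → ℕ) (V-pos : ∀ j → 1 ≤ j → 0 < V j) (V-fib : IsFibonacciFrom 1 V) where

  coprime-consecutive : Coprime (V 1) (V 2) → ∀ m → 1 ≤ m → Coprime (V m) (V (suc m))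
  coprime-consecutive V₁⊥V₂ (suc zero) _ = V₁⊥V₂
  coprime-consecutive V₁⊥V₂ (suc (suc m)) _ =
    Coprime.sym (subst (λ v → Coprime v (V (suc (suc m)))) (sym (V-fib (suc m) (s≤s z≤n)))
      (coprime-+ (coprime-consecutive V₁⊥V₂ (suc m) (s≤s z≤n))))

  V-<-+2 : ∀ {m} → 1 ≤ m → V m < V (suc (suc m))
  V-<-+2 {m} 1≤m = subst (V m <_) (sym (V-fib m 1≤m)) (m<n+m (V m) (V-pos (suc m) (s≤s z≤n)))

  V-≤-suc : ∀ {m} → 2 ≤ m → V m ≤ V (suc m)
  V-≤-suc {suc zero} (s≤s ())
  V-≤-suc {suc (suc m)} _ = ≤-trans (m≤m+n _ _) (≤-reflexive (sym (V-fib (suc m) (s≤s z≤n))))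

  V-< : ∀ {m j} → 1 ≤ m → 2 ≤ j → V m < V (j + m)
  V-< {j = suc zero} _ (s≤s ())
  V-< {j = suc (suc zero)} 1≤m _ = V-<-+2 1≤m
  V-< {j = suc (suc (suc j))} 1≤m _ =
    <-≤-trans (V-< {j = suc (suc j)} 1≤m (s≤s (s≤s z≤n))) (V-≤-suc (s≤s (s≤s z≤n)))

  module Generators (n d : ℕ) (1≤n : 1 ≤ n) (2≤d : 2 ≤ d) (2∣d : 2 ∣ d)
                    (V₁⊥V₂ : Coprime (V 1) (V 2)) (Vₙ⊥F[d] : Coprime (V n) (F d)) where

    a c : ℕ
    a = V n
    c = V (suc n)

    g : ℕ → ℕ
    g k = V (n + k * d)

    Generator : Pred ℕ 0ℓ
    Generator = GenSet V n d

    0<a : 0 < a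
    0<a = V-pos n 1≤n

    0<F[d] : 0 < F d
    0<F[d] = F-pos (≤-trans (s≤s z≤n) 2≤d)

    a⊥c : Coprime a c
    a⊥c = coprime-consecutive V₁⊥V₂ n 1≤n

    g-expand : ∀ k → g k ≡ F′ (k * d) * a + F (k * d) * c
    g-expand k = trans (cong V (+-comm n (k * d)))
      (fibonacci-expand V (λ j n≤j → V-fib j (≤-trans 1≤n n≤j)) (k * d))

    g-pos : ∀ k → 0 < g k
    g-pos k = V-pos (n + k * d) (≤-trans 1≤n (m≤m+n n (k * d)))

    g-< : ∀ {j k} → j < k → g j < g k
    g-< {j} j<k with m≤n⇒∃[o]m+o≡n j<k
    ... | o , refl = subst (λ i → g j < V i) reindex
      (V-< (≤-trans 1≤n (m≤m+n n (j * d))) (≤-trans 2≤d (m≤m+n d (o * d))))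
      where
      reindex : suc o * d + (n + j * d) ≡ n + (suc j + o) * d
      reindex = solve (n ∷ j ∷ o ∷ d ∷ [])

    g-<⁻¹ : ∀ {j k} → g j < g k → j < k
    g-<⁻¹ {j} {k} gj<gk with <-cmp j k
    ... | tri< j<k _ _ = j<k
    ... | tri≈ _ refl _ = ⊥-elim (<-irrefl refl gj<gk)
    ... | tri> _ _ k<j = ⊥-elim (<-asym gj<gk (g-< k<j))

    g0≡a : g 0 ≡ a
    g0≡a = cong V (+-identityʳ n)

    a≤g : ∀ k → a ≤ g k
    a≤g zero = ≤-reflexive (sym g0≡a)
    a≤g (suc k) = <⇒≤ (subst (_< g (suc k)) g0≡a (g-< {0} {suc k} (s≤s z≤n)))

    Small : ℕ → Set
    Small k = ∀ m → 1 ≤ m → m ≤ k → F (m * d) < a * F d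

    -- For x a sum of generators g j = F′ (j d) a + F (j d) c with j < k, p and q collect the
    -- coefficients of a and c, and t is the sum of the terms F ((k - j) d) given by d'Ocagne.
    record Certificate (k x : ℕ) : Set where
      field
        p q t : ℕ
        x≡pa+qc : x ≡ p * a + q * c
        F[d]∣q : F d ∣ q
        cross : p * F (k * d) ≡ q * F′ (k * d) + t
        t≤F[d]x : t ≤ F d * x
        0<x⇒0<t<F[d]x : 0 < x → 0 < t × t < F d * x

    certify : ∀ {k x} → Small k → ⟨ Generator ∩ (_< g k) ⟩ x → Certificate k x
    certify _ empty = record
      { p = 0 ; q = 0 ; t = 0 ; x≡pa+qc = refl ; F[d]∣q = F d ∣0 ; cross = refl
      ; t≤F[d]x = z≤n ; 0<x⇒0<t<F[d]x = λ () }
    certify {k} small (add {x = x} ((j , refl) , gj<gk) Sx)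
      with certify small Sx | m≤n⇒∃[o]m+o≡n (g-<⁻¹ {j} {k} gj<gk)
    ... | C | o , refl = record
      { p = F′ (j * d) + p
      ; q = F (j * d) + q
      ; t = F (suc o * d) + t
      ; x≡pa+qc = trans (cong₂ _+_ (g-expand j) x≡pa+qc)
                        (combination-+ (F′ (j * d)) p (F (j * d)) q a c)
      ; F[d]∣q = ∣m∣n⇒∣m+n (F-∣-F-* d j) F[d]∣q
      ; cross = cross-+ (F′ (j * d)) p (F (j * d)) q (F (suc o * d)) t generator-cross cross
      ; t≤F[d]x = <⇒≤ t<F[d]x
      ; 0<x⇒0<t<F[d]x = λ _ → ≤-trans (F-pos 0<md) (m≤m+n _ t) , t<F[d]x
      }
      where
      open Certificate C
      0<md : 0 < suc o * d
      0<md = ≤-trans (s≤s z≤n) (≤-trans 2≤d (m≤m+n d (o * d)))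
      generator-cross : F′ (j * d) * F (k * d) ≡ F (j * d) * F′ (k * d) + F (suc o * d)
      generator-cross = subst (λ i → F′ (j * d) * F i ≡ F (j * d) * F′ i + F (suc o * d)) split
        (F-dOcagne (∣n⇒∣m*n j 2∣d) (suc o * d))
        where
        split : j * d + suc o * d ≡ k * d
        split = solve (j ∷ o ∷ d ∷ [])
      F[md]<F[d]g : F (suc o * d) < F d * g j
      F[md]<F[d]g = <-≤-trans (small (suc o) (s≤s z≤n) (s≤s (m≤n+m o j)))
        (≤-trans (*-monoˡ-≤ (F d) (a≤g j)) (≤-reflexive (*-comm (g j) (F d))))
      t<F[d]x : F (suc o * d) + t < F d * (g j + x)
      t<F[d]x = subst (F (suc o * d) + t <_) (sym (*-distribˡ-+ (F d) (g j) x))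
        (+-mono-<-≤ F[md]<F[d]g t≤F[d]x)

    g-irreducible : ∀ {k} → Small k → ¬ ⟨ Generator ∩ (_< g k) ⟩ (g k)
    g-irreducible {k} small Sgk =
      let 0<t , t<F[d]g = 0<x⇒0<t<F[d]x (g-pos k)
      in <⇒≱ t<F[d]g (cross-bound {u = F′ (k * d)} {p = p} {t = t} 0<a a⊥c Vₙ⊥F[d]
                        (F-∣-F-* d k) F[d]∣q (g-expand k) x≡pa+qc cross 0<t)
      where open Certificate (certify small Sgk)

    b : ℕ
    b = g 1

    b-expand : b ≡ F′ d * a + F d * c
    b-expand = trans (g-expand 1) (cong (λ e → F′ e * a + F e * c) (*-identityˡ d))

    g-shift : ∀ k u w → F (suc k * d) ≡ u * F d → F (k * d) ≡ w * F d → u * b ≡ g (suc k) + w * a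
    g-shift k u w F[d+kd]≡uF[d] F[kd]≡wF[d] = begin
      u * b                                                ≡⟨ cong (u *_) b-expand ⟩
      u * (F′ d * a + F d * c)                             ≡⟨ distribute u (F′ d) (F d) a c ⟩
      (u * F′ d) * a + (u * F d) * c                       ≡⟨ cong₂ (λ s s′ → s * a + s′ * c) uF′[d]≡ (sym F[d+kd]≡uF[d]) ⟩
      (F′ (d + k * d) + w) * a + F (d + k * d) * c         ≡⟨ regroup (F′ (d + k * d)) w (F (d + k * d)) a c ⟩
      (F′ (d + k * d) * a + F (d + k * d) * c) + w * a     ≡⟨ cong (_+ w * a) (sym (g-expand (suc k))) ⟩
      g (suc k) + w * a                                    ∎
      where
      open ≡-Reasoning
      distribute : ∀ u s s′ a c → u * (s * a + s′ * c) ≡ (u * s) * a + (u * s′) * c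
      distribute = solve-∀
      regroup : ∀ s w s′ a c → (s + w) * a + s′ * c ≡ (s * a + s′ * c) + w * a
      regroup = solve-∀
      uF′[d]≡ : u * F′ d ≡ F′ (d + k * d) + w
      uF′[d]≡ = *-cancelʳ-≡ _ _ (F d) ⦃ >-nonZero 0<F[d] ⦄ (begin
        u * F′ d * F d                       ≡⟨ rotate u (F′ d) (F d) ⟩
        F′ d * (u * F d)                     ≡⟨ cong (F′ d *_) (sym F[d+kd]≡uF[d]) ⟩
        F′ d * F (d + k * d)                 ≡⟨ F-dOcagne 2∣d (k * d) ⟩
        F d * F′ (d + k * d) + F (k * d)     ≡⟨ cong (F d * F′ (d + k * d) +_) F[kd]≡wF[d] ⟩
        F d * F′ (d + k * d) + w * F d       ≡⟨ factor (F d) (F′ (d + k * d)) w ⟩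
        (F′ (d + k * d) + w) * F d           ∎)
        where
        rotate : ∀ u s f → u * s * f ≡ s * (u * f)
        rotate = solve-∀
        factor : ∀ f s w → f * s + w * f ≡ (s + w) * f
        factor = solve-∀

    quotient-+-quotient-≤ : ∀ k u w → F (suc k * d) ≡ u * F d → F (k * d) ≡ w * F d → w + w ≤ u
    quotient-+-quotient-≤ k u w F[d+kd]≡uF[d] F[kd]≡wF[d] =
      *-cancelʳ-≤ (w + w) u (F d) ⦃ >-nonZero 0<F[d] ⦄ (begin
        (w + w) * F d             ≡⟨ *-distribʳ-+ (F d) w w ⟩
        w * F d + w * F d         ≡⟨ cong₂ _+_ (sym F[kd]≡wF[d]) (sym F[kd]≡wF[d]) ⟩
        F (k * d) + F (k * d)     ≤⟨ F-+-F-≤ 2≤d (k * d) ⟩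
        F (d + k * d)             ≡⟨ F[d+kd]≡uF[d] ⟩
        u * F d                   ∎)
      where open ≤-Reasoning

    g≡*a+*b : ∀ k → a * F d ≤ F (suc k * d) → ∃[ x ] ∃[ y ] y < a × g (suc k) ≡ x * a + y * b
    g≡*a+*b k bound with F-∣-F-* d (suc k) | F-∣-F-* d k
    ... | divides u F[d+kd]≡uF[d] | divides w F[kd]≡wF[d] =
      t * b ∸ w , r , m%n<n u a ,
      subtract-shift {r = r} {t = t} (g-shift k u w F[d+kd]≡uF[d] F[kd]≡wF[d]) (m≡m%n+[m/n]*n u a) (<⇒≤ w<tb)
      where
      instance
        _ : NonZero a
        _ = >-nonZero 0<a
      r t : ℕ
      r = u % a
      t = u / a
      a≤u : a ≤ u
      a≤u = *-cancelʳ-≤ a u (F d) ⦃ >-nonZero 0<F[d] ⦄ (subst (a * F d ≤_) F[d+kd]≡uF[d] bound)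
      w<tb : w < t * b
      w<tb = ≰⇒> λ tb≤w → <⇒≱ (begin-strict
        w + w             ≤⟨ quotient-+-quotient-≤ k u w F[d+kd]≡uF[d] F[kd]≡wF[d] ⟩
        u                 ≡⟨ m≡m%n+[m/n]*n u a ⟩
        r + t * a         <⟨ +-monoˡ-< (t * a) (m%n<n u a) ⟩
        a + t * a         ≤⟨ +-monoˡ-≤ (t * a) (m≤n*m a t ⦃ >-nonZero (m≥n⇒m/n>0 a≤u) ⦄) ⟩
        t * a + t * a     ≤⟨ +-mono-≤ (*-monoʳ-≤ t (a≤g 1)) (*-monoʳ-≤ t (a≤g 1)) ⟩
        t * b + t * b     ∎) (+-mono-≤ tb≤w tb≤w)
        where open ≤-Reasoning

    a-generator : ∀ {k} → 1 ≤ k → (Generator ∩ (_< g k)) a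
    a-generator {k} 1≤k = (0 , cong V (sym (+-identityʳ n))) , subst (_< g k) g0≡a (g-< {0} {k} 1≤k)

    b-multiple-below-g : ∀ k r → a * F d ≤ F (suc k * d) → r < a → ⟨ Generator ∩ (_< g (suc k)) ⟩ (r * b)
    b-multiple-below-g zero zero _ _ = empty
    b-multiple-below-g zero (suc r) bound r<a = ⊥-elim (<⇒≱ r<a (≤-trans a≤1 (s≤s z≤n)))
      where
      a≤1 : a ≤ 1
      a≤1 = *-cancelʳ-≤ a 1 (F d) ⦃ >-nonZero 0<F[d] ⦄
        (subst (a * F d ≤_) (trans (cong F (*-identityˡ d)) (sym (*-identityˡ (F d)))) bound)
    b-multiple-below-g (suc k) r _ _ = ⟨⟩-* r ((1 , refl) , g-< {1} {suc (suc k)} (s≤s (s≤s z≤n)))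

    g-reducible : ∀ {k} → 1 ≤ k → a * F d ≤ F (k * d) → ⟨ Generator ∩ (_< g k) ⟩ (g k)
    g-reducible {suc k} 1≤k bound with g≡*a+*b k bound
    ... | x , r , r<a , g≡xa+rb =
      subst ⟨ _ ⟩ (sym g≡xa+rb) (⟨⟩-+ (⟨⟩-* x (a-generator 1≤k)) (b-multiple-below-g k r bound r<a))

    positive-index : ∀ {κ} → a * F d ≤ F (κ * d) → 1 ≤ κ
    positive-index {zero} bound = ⊥-elim (<⇒≱ (*-mono-< 0<a 0<F[d]) bound)
    positive-index {suc _} _ = s≤s z≤n

    module _ {κ} (κ-bound : a * F d ≤ F (κ * d)) (κ-least : ∀ k → 1 ≤ k → k < κ → F (k * d) < a * F d) where

      g-minGen : ∀ {k} → k < κ → MinGen ⟨ Generator ⟩ (g k)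
      g-minGen {k} k<κ = Equivalence.from MinGen⟨⟩⇔
        ( (k , refl)
        , (λ gk≡0 → <⇒≢ (g-pos k) (sym gk≡0))
        , g-irreducible (λ m 1≤m m≤k → κ-least m 1≤m (≤-<-trans m≤k k<κ)))

      minGen-index : ∀ {x} → MinGen ⟨ Generator ⟩ x → ∃[ k ] k < κ × x ≡ g k
      minGen-index mg with Equivalence.to MinGen⟨⟩⇔ mg
      ... | (k , refl) , _ , irreducible = k , ≰⇒> κ≰k , refl
        where
        κ≰k : ¬ κ ≤ k
        κ≰k κ≤k = irreducible (g-reducible (≤-trans (positive-index κ-bound) κ≤k)
                                           (≤-trans κ-bound (F-mono-≤ (*-monoˡ-≤ d κ≤k))))

      ∈⇔MinGen : ∀ x → x ∈ applyUpTo g κ ⇔ MinGen ⟨ Generator ⟩ x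
      ∈⇔MinGen x = mk⇔
        (λ x∈ → let k , k<κ , x≡gk = ∈-applyUpTo⁻ g x∈ in subst (MinGen _) (sym x≡gk) (g-minGen k<κ))
        (λ mg → let k , k<κ , x≡gk = minGen-index mg in subst (_∈ _) (sym x≡gk) (∈-applyUpTo⁺ g k<κ))

      embeddingDimension : EmbeddingDimension ⟨ Generator ⟩ κ
      embeddingDimension =
        applyUpTo g κ , length-applyUpTo g κ , applyUpTo⁺₁ g κ (λ i<j _ → <⇒≢ (g-< i<j)) , ∈⇔MinGen

theorem3p1p1 : (V : ℕ → ℕ) (n d : ℕ)
    → (∀ j → 1 ≤ j → 0 < V j)
    → (∀ j → 1 ≤ j → V (suc (suc j)) ≡ V (suc j) + V j)
    → 1 ≤ n → 2 ≤ d → 2 ∣ d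
    → gcd (V 1) (V 2) ≡ 1 → gcd (V n) (F d) ≡ 1
    → Σ ℕ λ κ → (1 ≤ κ × V n * F d ≤ F (κ * d)
                  × (∀ k → 1 ≤ k → k < κ → F (k * d) < V n * F d))
                × EmbeddingDimension ⟨ GenSet V n d ⟩ κ
theorem3p1p1 V n d V-pos V-fib 1≤n 2≤d 2∣d gcd[V₁,V₂]≡1 gcd[Vₙ,F[d]]≡1
  with least-witness (λ k → V n * F d ≤? F (k * d)) {V n} (*-F-≤-F-* 2≤d (V n))
... | κ , κ-bound , κ-least = κ , (positive-index κ-bound , κ-bound , below) , embeddingDimension κ-bound below
  where
  open FibonacciLike.Generators V V-pos V-fib n d 1≤n 2≤d 2∣d
         (gcd≡1⇒coprime gcd[V₁,V₂]≡1) (gcd≡1⇒coprime gcd[Vₙ,F[d]]≡1)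
  below : ∀ k → 1 ≤ k → k < κ → F (k * d) < V n * F d
  below _ _ k<κ = ≰⇒> (κ-least k<κ)
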